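{- Let $n\geq 1$. The maximum, over all strategies, of the success probability in the New Hats-on-a-line Game with two hat colours and $n$ players is $1-2^{ -n}$.
   Context: The New Hats-on-a-line Game with $q$ hat colours and $n$ players: players $P_1,\dots,P_n$ stand in a line. Each player receives a hat whose colour is chosen uniformly at random from a fixed set of $q$ colours, independently of the other hats. Player $P_i$ sees exactly the hats of $P_{i+1},\dots,P_n$ (not his own, nor those of $P_1,\dots,P_{i-1}$). The players respond one at a time in the order $P_1,P_2,\dots,P_n$; each response is either a guess of the player's own hat colour or a pass, and every player hears all earlier responses. Apart from agreeing on a strategy beforehand, no communication is allowed. A strategy specifies, for each player, the response as a function of the hats that player sees and the responses that player has heard. The players win if at least one player guesses correctly and no player guesses incorrectly; the success probability of a strategy is the probability of winning over the random hat assignment. -}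

module Defs where

open import Data.Nat using (ℕ; zero; suc; _^_; _∸_)
open import Data.Fin using (Fin; zero; suc; _≟_)
open import Data.Maybe using (Maybe; just; nothing)
open import Data.Bool using (Bool; true; false; _∧_; not)
open import Data.List using (List; []; _∷_; _++_; [_]; map; concatMap; filter; length)
open import Data.Bool.ListAction using (any)
open import Data.Vec using (Vec; []; _∷_; toList)
open import Data.Product using (_×_; _,_)
open import Relation.Nullary using (does)
open import Relation.Nullary.Decidable using (T?)

Colour : Set
Colour = Fin 2

-- A response: 'nothing' = pass, 'just c' = guess colour c.
Response : Set
Response = Maybe Colour

-- Player i (i : Fin n, 0-based, i.e. P_{i+1})
-- responds as a function of the list of hats he sees (the hats of all later
-- players, in line order) and the list of responses he has heard (those of
-- all earlier players, in order).
Strategy : ℕ → Set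
Strategy n = Fin n → List Colour → List Response → Response

play : ∀ {m} → Strategy m → Vec Colour m → List Response → List (Response × Colour)
play s []       hist = []
play s (h ∷ hs) hist =
  let r = s zero (toList hs) hist
  in (r , h) ∷ play (λ i → s (suc i)) hs (hist ++ [ r ])

correct : Response × Colour → Bool
correct (nothing , h) = false
correct (just c  , h) = does (c ≟ h)

wrong : Response × Colour → Bool
wrong (nothing , h) = false
wrong (just c  , h) = not (does (c ≟ h))

wins : ∀ {n} → Strategy n → Vec Colour n → Bool
wins s hats = let out = play s hats [] in any correct out ∧ not (any wrong out)

allHats : (n : ℕ) → List (Vec Colour n)
allHats zero    = [ [] ]
allHats (suc n) = concatMap (λ v → (zero ∷ v) ∷ (suc zero ∷ v) ∷ []) (allHats n)

-- Number of winning hat assignments; success probability = successCount s / 2^n.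
successCount : ∀ {n} → Strategy n → ℕ
successCount {n} s = length (filter (λ v → T? (wins s v)) (allHats n))

module Submission where

-- Upper bound: whatever the strategy, some hat assignment loses.  Take a losing
-- assignment for P₂, …, Pₙ in the play where P₁ passes, and then give P₁ any
-- hat if he does pass and the colour he does not name if he guesses.
--
-- Lower bound: the first player who sees only hats of colour 0 guesses 1 and
-- everybody else passes.  If some hat has colour 1, that player is the one
-- wearing the last such hat and he guesses right; only the all-0 assignment
-- loses.

open import Defs
open import Data.Nat using (ℕ; zero; suc; _+_; _≤_; _<_; _^_; _∸_)
open import Data.Nat.Properties using (+-identityʳ; +-suc; ∸-monoˡ-≤)
open import Data.Fin using (zero; suc; opposite)
open import Data.Maybe using (Maybe; just; nothing; is-just)
open import Data.Bool using (Bool; true; false; _∧_; _∨_; not; if_then_else_; T)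
open import Data.Bool.Properties using (∧-zeroʳ; ∨-assoc; ∨-identityʳ; ∨-zeroʳ)
open import Data.Bool.ListAction using (any)
open import Data.List using (List; []; _∷_; _++_; [_]; concatMap; filter; length)
open import Data.List.Properties using (filter-notAll; filter-≐)
open import Data.List.Relation.Unary.Any using (here; there)
import Data.List.Relation.Unary.Any as Any
open import Data.List.Membership.Propositional using (_∈_; lose)
open import Data.List.Membership.Propositional.Properties using (∈-concatMap⁺)
open import Data.Vec using (Vec; []; _∷_; toList)
open import Data.Product using (_×_; Σ; _,_)
open import Relation.Nullary.Decidable using (T?)
open import Relation.Binary.PropositionalEquality
  using (_≡_; refl; sym; trans; cong; cong₂; subst; module ≡-Reasoning)

countTrue : ∀ {A : Set} → (A → Bool) → List A → ℕ
countTrue p xs = length (filter (λ x → T? (p x)) xs)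

countTrue-cong : ∀ {A : Set} {p q : A → Bool} → (∀ x → p x ≡ q x) → ∀ xs → countTrue p xs ≡ countTrue q xs
countTrue-cong {p = p} {q} p≡q xs =
  cong length (filter-≐ (λ x → T? (p x)) (λ x → T? (q x))
                        ((λ {x} → subst T (p≡q x)) , (λ {x} → subst T (sym (p≡q x)))) xs)

any-++ : ∀ {A : Set} (p : A → Bool) xs ys → any p (xs ++ ys) ≡ any p xs ∨ any p ys
any-++ p []       ys = refl
any-++ p (x ∷ xs) ys = trans (cong (p x ∨_) (any-++ p xs ys)) (sym (∨-assoc (p x) _ _))

any-is-just-++-nothing : ∀ {A : Set} (xs : List (Maybe A)) → any is-just (xs ++ [ nothing ]) ≡ any is-just xs
any-is-just-++-nothing xs = trans (any-++ is-just xs _) (∨-identityʳ _)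

any-is-just-++-just : ∀ {A : Set} (xs : List (Maybe A)) x → any is-just (xs ++ [ just x ]) ≡ true
any-is-just-++-just xs x = trans (any-++ is-just xs _) (∨-zeroʳ _)

2^n+2^n≡2^[1+n] : ∀ n → 2 ^ n + 2 ^ n ≡ 2 ^ suc n
2^n+2^n≡2^[1+n] n = cong (2 ^ n +_) (sym (+-identityʳ (2 ^ n)))

extend : ∀ {n} → Vec Colour n → List (Vec Colour (suc n))
extend v = (zero ∷ v) ∷ (suc zero ∷ v) ∷ []

∈-allHats : ∀ {n} (v : Vec Colour n) → v ∈ allHats n
∈-allHats []      = here refl
∈-allHats (c ∷ w) = ∈-concatMap⁺ extend (Any.map (λ { refl → ∈-extend c }) (∈-allHats w))
  where
    ∈-extend : ∀ c → (c ∷ w) ∈ extend w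
    ∈-extend zero       = here refl
    ∈-extend (suc zero) = there (here refl)

length-concatMap-extend : ∀ {n} (xs : List (Vec Colour n)) →
  length (concatMap extend xs) ≡ length xs + length xs
length-concatMap-extend []       = refl
length-concatMap-extend (x ∷ xs) =
  cong suc (trans (cong suc (length-concatMap-extend xs)) (sym (+-suc _ _)))

length-allHats : ∀ n → length (allHats n) ≡ 2 ^ n
length-allHats zero    = refl
length-allHats (suc n) = trans (length-concatMap-extend (allHats n))
  (trans (cong₂ _+_ (length-allHats n) (length-allHats n)) (2^n+2^n≡2^[1+n] n))

winsFrom : ∀ {n} → Strategy n → Vec Colour n → List Response → Bool
winsFrom s hats hist = let out = play s hats hist in any correct out ∧ not (any wrong out)

losingColour : Response → Colour
losingColour nothing  = zero
losingColour (just c) = opposite c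

losingHats : ∀ n (s : Strategy n) hist → Σ (Vec Colour n) (λ v → winsFrom s v hist ≡ false)
losingHats zero    s hist = [] , refl
losingHats (suc n) s hist with losingHats n (λ i → s (suc i)) (hist ++ [ nothing ])
... | w , rest-loses = losingColour (s zero (toList w) hist) ∷ w , first-loses
  where
    first-loses : winsFrom s (losingColour (s zero (toList w) hist) ∷ w) hist ≡ false
    first-loses with s zero (toList w) hist
    ... | nothing         = rest-loses
    ... | just zero       = ∧-zeroʳ _
    ... | just (suc zero) = ∧-zeroʳ _

successCount<2^n : ∀ {n} (s : Strategy n) → successCount s < 2 ^ n
successCount<2^n {n} s with losingHats n s []
... | v , loses = subst (successCount s <_) (length-allHats n)
                    (filter-notAll (λ v → T? (wins s v)) (allHats n)
                      (lose (∈-allHats v) (subst T loses)))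

isZero : Colour → Bool
isZero zero    = true
isZero (suc _) = false

allZero : List Colour → Bool
allZero []      = true
allZero (c ∷ l) = isZero c ∧ allZero l

notAllZero : ∀ {n} → Vec Colour n → Bool
notAllZero v = not (allZero (toList v))

guessLastOne : ∀ {n} → Strategy n
guessLastOne i seen heard =
  if any is-just heard then nothing else if allZero seen then just (suc zero) else nothing

guessLastOne-silentAfterGuess : ∀ {n} (v : Vec Colour n) hist → any is-just hist ≡ true →
  (f : Response × Colour → Bool) → (∀ c → f (nothing , c) ≡ false) →
  any f (play guessLastOne v hist) ≡ false
guessLastOne-silentAfterGuess []      hist guessed f f-pass = refl
guessLastOne-silentAfterGuess (c ∷ w) hist guessed f f-pass rewrite guessed | f-pass c =
  guessLastOne-silentAfterGuess w (hist ++ [ nothing ])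
    (trans (any-is-just-++-nothing hist) guessed) f f-pass

winsFrom-guessLastOne : ∀ {n} (v : Vec Colour n) hist → any is-just hist ≡ false →
  winsFrom guessLastOne v hist ≡ notAllZero v
winsFrom-guessLastOne []      hist unguessed = refl
winsFrom-guessLastOne (c ∷ w) hist unguessed rewrite unguessed with allZero (toList w) in seesZeros
... | true = trans
  (cong₂ (λ a b → (correct (just (suc zero) , c) ∨ a) ∧ not (wrong (just (suc zero) , c) ∨ b))
         (guessLastOne-silentAfterGuess w _ (any-is-just-++-just hist _) correct (λ _ → refl))
         (guessLastOne-silentAfterGuess w _ (any-is-just-++-just hist _) wrong (λ _ → refl)))
  (lone-guess c)
  where
    lone-guess : ∀ c → (correct (just (suc zero) , c) ∨ false) ∧ not (wrong (just (suc zero) , c) ∨ false)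
                       ≡ not (isZero c ∧ true)
    lone-guess zero       = refl
    lone-guess (suc zero) = refl
... | false = begin
  winsFrom guessLastOne w (hist ++ [ nothing ])
    ≡⟨ winsFrom-guessLastOne w _ (trans (any-is-just-++-nothing hist) unguessed) ⟩
  not (allZero (toList w))  ≡⟨ cong not seesZeros ⟩
  true                      ≡⟨ cong not (∧-zeroʳ (isZero c)) ⟨
  not (isZero c ∧ false)    ∎
  where open ≡-Reasoning

countTrue-notAllZero-concatMap-extend : ∀ {n} (xs : List (Vec Colour n)) →
  countTrue notAllZero (concatMap extend xs) ≡ countTrue notAllZero xs + length xs
countTrue-notAllZero-concatMap-extend []       = refl
countTrue-notAllZero-concatMap-extend (x ∷ xs) with allZero (toList x)
... | true  = trans (cong suc (countTrue-notAllZero-concatMap-extend xs)) (sym (+-suc _ _))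
... | false = cong suc (trans (cong suc (countTrue-notAllZero-concatMap-extend xs)) (sym (+-suc _ _)))

suc-countTrue-notAllZero : ∀ n → suc (countTrue notAllZero (allHats n)) ≡ 2 ^ n
suc-countTrue-notAllZero zero    = refl
suc-countTrue-notAllZero (suc n) = begin
  suc (countTrue notAllZero (concatMap extend (allHats n)))
    ≡⟨ cong suc (countTrue-notAllZero-concatMap-extend (allHats n)) ⟩
  suc (countTrue notAllZero (allHats n)) + length (allHats n)
    ≡⟨ cong₂ _+_ (suc-countTrue-notAllZero n) (length-allHats n) ⟩
  2 ^ n + 2 ^ n
    ≡⟨ 2^n+2^n≡2^[1+n] n ⟩
  2 ^ suc n ∎
  where open ≡-Reasoning

suc-successCount-guessLastOne : ∀ n → suc (successCount (guessLastOne {n})) ≡ 2 ^ n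
suc-successCount-guessLastOne n =
  trans (cong suc (countTrue-cong (λ v → winsFrom-guessLastOne v [] refl) (allHats n)))
        (suc-countTrue-notAllZero n)

theorem2 : (n : ℕ) → 1 ≤ n →
    Σ (Strategy n) (λ s → successCount s ≡ 2 ^ n ∸ 1)
    × ((s : Strategy n) → successCount s ≤ 2 ^ n ∸ 1)
theorem2 n _ =
  (guessLastOne , cong (_∸ 1) (suc-successCount-guessLastOne n)) ,
  (λ s → ∸-monoˡ-≤ 1 (successCount<2^n s))
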